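{- Let $I$ be an interval-poset of size $n$ corresponding to the Tamari interval $[D_1,D_2]$. Let $\mathrm{DC}(I)=(\mathrm{dc}_0(I),\mathrm{dc}_1(I),\dots,\mathrm{dc}_{n-1}(I))$, where $\mathrm{dc}_0(I)$ is the number of decreasing roots of $I$ and $\mathrm{dc}_i(I)$ is the number of decreasing children of vertex $i$. Then $\mathrm{DC}(I)=(\mathrm{contacts}(D_1),\mathrm{contacts}_1(D_1),\dots,\mathrm{contacts}_{n-1}(D_1))$.
   Context: An interval-poset of size $n$ is a partial order $\triangleleft$ on $\{1,\dots,n\}$ such that for all $a<b<c$: $a\triangleleft c\Rightarrow b\triangleleft c$ and $c\triangleleft a\Rightarrow b\triangleleft a$. A decreasing relation is $x\triangleleft y$ with $x>y$; the final forest is the poset of decreasing relations. A vertex $b$ is a decreasing root if there is no $a<b$ with $b\triangleleft a$; the decreasing children of $b$ are the $c>b$ such that $c\triangleleft b$ is a cover relation of the final forest. Dyck paths are words in up-step $1$/down-step $0$; $\mathrm{tree}(D_1 1 D_2 0)$ is the binary tree with left subtree $\mathrm{tree}(D_1)$ and right subtree $\mathrm{tree}(D_2)$ ($\mathrm{tree}$ of the empty path is empty); binary tree nodes are $v_1,\dots,v_n$ in in-order. The Tamari order is generated by right rotations $y(x(A,B),C)\to x(A,y(B,C))$. A Tamari interval $[D_1,D_2]$ with $T_i=\mathrm{tree}(D_i)$, $T_1\le T_2$, corresponds to the interval-poset where for $a<b$: $b\triangleleft a$ iff $v_b$ is in the right subtree of $v_a$ in $T_1$, and $a\triangleleft b$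 iff $v_a$ is in the left subtree of $v_b$ in $T_2$. For a Dyck path $D$: $\mathrm{contacts}(D)$ is the number of points at height $0$ other than the last point; $\mathrm{contacts}_i(D)$ is the number of non-final contacts (points at its base height other than its last point) of the Dyck subpath strictly between the $i$-th up-step and its matching down-step. -}

module Defs where

open import Data.Nat using (ℕ; zero; suc; _+_; _∸_; _≡ᵇ_; _<ᵇ_)
open import Data.Bool using (Bool; true; false; _∧_; _∨_; not; if_then_else_)
open import Data.List using (List; []; _∷_; _++_; map; upTo)
open import Relation.Binary.Construct.Closure.ReflexiveTransitive using (Star)

anyᵇ : {A : Set} → (A → Bool) → List A → Bool
anyᵇ p []       = false
anyᵇ p (x ∷ xs) = p x ∨ anyᵇ p xs

countᵇ : {A : Set} → (A → Bool) → List A → ℕ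
countᵇ p []       = 0
countᵇ p (x ∷ xs) = if p x then suc (countᵇ p xs) else countᵇ p xs

block : ℕ → ℕ → List ℕ
block a k = map (λ i → a + suc i) (upTo k)

data Tree : Set where
  leaf : Tree
  node : Tree → Tree → Tree

size : Tree → ℕ
size leaf       = 0
size (node l r) = size l + suc (size r)

-- in-order labels of the nodes of t, when its first node gets label s+1
labels : ℕ → Tree → List ℕ
labels s leaf       = []
labels s (node l r) = labels s l ++ (s + suc (size l)) ∷ labels (s + suc (size l)) r

-- rightSub s t a b : node v_b lies in the right subtree of node v_a
-- (labels in in-order, first node of t labelled s+1)
rightSub : ℕ → Tree → ℕ → ℕ → Bool
rightSub s leaf       a b = false
rightSub s (node l r) a b =
  ((a ≡ᵇ root) ∧ anyᵇ (λ x → x ≡ᵇ b) (labels root r))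
  ∨ rightSub s l a b ∨ rightSub root r a b
  where root = s + suc (size l)

-- leftSub s t a b : node v_a lies in the left subtree of node v_b
leftSub : ℕ → Tree → ℕ → ℕ → Bool
leftSub s leaf       a b = false
leftSub s (node l r) a b =
  ((b ≡ᵇ root) ∧ anyᵇ (λ x → x ≡ᵇ a) (labels s l))
  ∨ leftSub s l a b ∨ leftSub root r a b
  where root = s + suc (size l)

data RightRot : Tree → Tree → Set where
  rot-here  : ∀ {a b c} → RightRot (node (node a b) c) (node a (node b c))
  rot-left  : ∀ {l l′ r} → RightRot l l′ → RightRot (node l r) (node l′ r)
  rot-right : ∀ {l r r′} → RightRot r r′ → RightRot (node l r) (node l r′)

_≤T_ : Tree → Tree → Set
_≤T_ = Star RightRot

-- Dyck paths: lists of steps, true = up-step 1, false = down-step 0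

Dyck : Set
Dyck = List Bool

toDyck : Tree → Dyck
toDyck leaf       = []
toDyck (node l r) = toDyck l ++ true ∷ (toDyck r ++ false ∷ [])

heightsBut-last : ℕ → Dyck → List ℕ
heightsBut-last h []           = []
heightsBut-last h (true ∷ xs)  = h ∷ heightsBut-last (suc h) xs
heightsBut-last h (false ∷ xs) = h ∷ heightsBut-last (h ∸ 1) xs

contacts : Dyck → ℕ
contacts d = countᵇ (λ h → h ≡ᵇ 0) (heightsBut-last 0 d)

-- the part of the path after the (k+1)-th up-step
afterUp : ℕ → Dyck → Dyck
afterUp k       []           = []
afterUp k       (false ∷ xs) = afterUp k xs
afterUp zero    (true ∷ xs)  = xs
afterUp (suc k) (true ∷ xs)  = afterUp k xs

-- the prefix of a path before the first down-step going below base height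
-- (h = current height above base)
untilMatch : ℕ → Dyck → Dyck
untilMatch h       []           = []
untilMatch h       (true ∷ xs)  = true ∷ untilMatch (suc h) xs
untilMatch zero    (false ∷ xs) = []
untilMatch (suc h) (false ∷ xs) = false ∷ untilMatch h xs

-- subpath strictly between the i-th up-step (i ≥ 1) and its matching down-step
innerPath : ℕ → Dyck → Dyck
innerPath i d = untilMatch 0 (afterUp (i ∸ 1) d)

contactsAt : ℕ → Dyck → ℕ
contactsAt i d = contacts (innerPath i d)

-- The interval-poset of the Tamari interval [toDyck t1, toDyck t2]
-- on vertices 1..n:  x ◁ y  iff  x = y, or
--   y < x and v_x is in the right subtree of v_y in t1, or
--   x < y and v_x is in the left subtree of v_y in t2.

ipRel : Tree → Tree → ℕ → ℕ → Bool
ipRel t1 t2 x y =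
  (x ≡ᵇ y) ∨ ((y <ᵇ x) ∧ rightSub 0 t1 y x) ∨ ((x <ᵇ y) ∧ leftSub 0 t2 x y)

vertices : ℕ → List ℕ
vertices n = block 0 n

isDecRoot : Tree → Tree → ℕ → Bool
isDecRoot t1 t2 b = not (anyᵇ (λ a → ipRel t1 t2 b a) (block 0 (b ∸ 1)))

-- c > b is a decreasing child of b: c ◁ b is a cover relation of the final
-- forest (the poset of decreasing relations), i.e. c ◁ b and there is no d
-- with c ◁ d ◁ b decreasing relations, i.e. b < d < c.
isDecChild : Tree → Tree → ℕ → ℕ → Bool
isDecChild t1 t2 b c =
  (b <ᵇ c) ∧ ipRel t1 t2 c b
  ∧ not (anyᵇ (λ d → ipRel t1 t2 c d ∧ ipRel t1 t2 d b) (block b (c ∸ suc b)))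

dc₀ : ℕ → Tree → Tree → ℕ
dc₀ n t1 t2 = countᵇ (isDecRoot t1 t2) (vertices n)

dc : ℕ → Tree → Tree → ℕ → ℕ
dc n t1 t2 i = countᵇ (isDecChild t1 t2 i) (vertices n)

-- The decreasing relations c ◁ a (a < c) of I say exactly that v_c lies in the
-- right subtree of v_a in t1, so both statistics only depend on t1.  In t1 numbered from s+1:
--   * the decreasing roots are the nodes of the left spine (roots-count);
--   * the decreasing children of v_i are the decreasing roots of the right
--     subtree r of v_i, which carries the consecutive labels (i, i+|r|]
--     (children-count), so their number is the left-spine length of r.
-- On the Dyck side, path(t) touches height 0 once per left-spine node
-- (contacts-spine), and the subpath enclosed by the i-th up-step is path(r)
-- (contactsAt-spine).  The file develops, in order: Boolean reflection and
-- counting over integer ranges, the label arithmetic of binary trees and the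
-- relation rightSub, right subtrees of labelled nodes, the two counting
-- results, the translation from the interval-poset, the Dyck-path side, and
-- finally the theorem.
module Submission where

open import Defs
open import Data.Nat using (ℕ; _≤_; _<_)
open import Data.Product using (_×_)
open import Relation.Binary.PropositionalEquality using (_≡_)
open import Data.Nat using (zero; suc; _+_; _∸_; _≡ᵇ_; _<ᵇ_; s≤s)
open import Data.Nat.Properties
open import Data.Bool using (Bool; true; false; _∧_; _∨_; not; T)
open import Data.Bool.Properties using (T-≡; ∨-zeroʳ; ∨-identityʳ; ∧-identityʳ; ∧-zeroʳ)
open import Function.Bundles using (Equivalence)
open import Data.List using (List; []; _∷_; _++_; applyUpTo)
open import Data.List.Properties using (++-assoc; ++-identityʳ; map-applyUpTo)
open import Data.List.Relation.Unary.Any using (here; there)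
open import Data.List.Membership.Propositional using (_∈_)
open import Data.Product using (Σ; ∃-syntax; _,_; proj₁; proj₂)
open import Data.Sum using (_⊎_; inj₁; inj₂)
open import Data.Empty using (⊥-elim)
open import Relation.Nullary using (¬_; yes; no)
open import Relation.Binary.Definitions using (tri<; tri≈; tri>)
open import Relation.Binary.PropositionalEquality
  using (refl; sym; trans; cong; cong₂; subst; module ≡-Reasoning)

T⇒≡true : ∀ {b} → T b → b ≡ true
T⇒≡true = Equivalence.to T-≡

≡true⇒T : ∀ {b} → b ≡ true → T b
≡true⇒T = Equivalence.from T-≡

false-unless : ∀ {P : Set} b → (b ≡ true → P) → ¬ P → b ≡ false
false-unless false _     _  = refl
false-unless true  b⇒P ¬P = ⊥-elim (¬P (b⇒P refl))

≡ᵇ-true : ∀ {m n} → m ≡ n → (m ≡ᵇ n) ≡ true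
≡ᵇ-true {m} {n} m≡n = T⇒≡true (≡⇒≡ᵇ m n m≡n)

≡ᵇ-false : ∀ {m n} → ¬ m ≡ n → (m ≡ᵇ n) ≡ false
≡ᵇ-false {m} {n} = false-unless (m ≡ᵇ n) (λ e → ≡ᵇ⇒≡ m n (≡true⇒T e))

<ᵇ-true : ∀ {m n} → m < n → (m <ᵇ n) ≡ true
<ᵇ-true m<n = T⇒≡true (<⇒<ᵇ m<n)

<ᵇ-false : ∀ {m n} → ¬ m < n → (m <ᵇ n) ≡ false
<ᵇ-false {m} {n} = false-unless (m <ᵇ n) (λ e → <ᵇ⇒< m n (≡true⇒T e))

∨-true : ∀ x y → x ∨ y ≡ true → x ≡ true ⊎ y ≡ true
∨-true true  _ _ = inj₁ refl
∨-true false _ e = inj₂ e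

∧-true : ∀ x y → x ∧ y ≡ true → x ≡ true × y ≡ true
∧-true true _ e = refl , e

∧-congʳ : ∀ x {y z} → (x ≡ true → y ≡ z) → x ∧ y ≡ x ∧ z
∧-congʳ true  y≡z = y≡z refl
∧-congʳ false _   = refl

any-intro : ∀ {A : Set} {p : A → Bool} {x xs} → x ∈ xs → p x ≡ true → anyᵇ p xs ≡ true
any-intro (here refl) px rewrite px = refl
any-intro {p = p} {xs = y ∷ _} (there x∈) px rewrite any-intro {p = p} x∈ px = ∨-zeroʳ (p y)

any-elim : ∀ {A : Set} {p : A → Bool} xs → anyᵇ p xs ≡ true → ∃[ x ] x ∈ xs × p x ≡ true
any-elim {p = p} (x ∷ xs) e with p x in px
... | true  = x , here refl , px
... | false with any-elim xs e
...   | y , y∈ , py = y , there y∈ , py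

any-false : ∀ {A : Set} {p : A → Bool} xs → (∀ x → x ∈ xs → p x ≡ false) → anyᵇ p xs ≡ false
any-false []       _ = refl
any-false (x ∷ xs) h rewrite h x (here refl) = any-false xs (λ y y∈ → h y (there y∈))

any-cong : ∀ {A : Set} {p q : A → Bool} xs → (∀ x → x ∈ xs → p x ≡ q x) → anyᵇ p xs ≡ anyᵇ q xs
any-cong []       _ = refl
any-cong (x ∷ xs) h = cong₂ _∨_ (h x (here refl)) (any-cong xs (λ y y∈ → h y (there y∈)))

count-cong : ∀ {A : Set} {p q : A → Bool} xs → (∀ x → x ∈ xs → p x ≡ q x) →
             countᵇ p xs ≡ countᵇ q xs
count-cong []       _ = refl
count-cong (x ∷ xs) h rewrite h x (here refl) | count-cong xs (λ y y∈ → h y (there y∈)) = refl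

count-zero : ∀ {A : Set} {p : A → Bool} xs → (∀ x → x ∈ xs → p x ≡ false) → countᵇ p xs ≡ 0
count-zero []       _ = refl
count-zero (x ∷ xs) h rewrite h x (here refl) = count-zero xs (λ y y∈ → h y (there y∈))

count-∷-true : ∀ {A : Set} (p : A → Bool) {x} xs → p x ≡ true →
               countᵇ p (x ∷ xs) ≡ suc (countᵇ p xs)
count-∷-true p xs px rewrite px = refl

count-++ : ∀ {A : Set} (p : A → Bool) xs ys → countᵇ p (xs ++ ys) ≡ countᵇ p xs + countᵇ p ys
count-++ p []       ys = refl
count-++ p (x ∷ xs) ys with p x
... | true  = cong suc (count-++ p xs ys)
... | false = count-++ p xs ys

range : ℕ → ℕ → List ℕ
range a zero    = []
range a (suc m) = suc a ∷ range (suc a) m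

between : ℕ → ℕ → List ℕ
between s b = range s (b ∸ suc s)

∈-range⁻ : ∀ {a m x} → x ∈ range a m → a < x × x ≤ a + m
∈-range⁻ {a} {suc m} (here refl) = ≤-refl , subst (suc a ≤_) (sym (+-suc a m)) (s≤s (m≤m+n a m))
∈-range⁻ {a} {suc m} {x} (there x∈) with ∈-range⁻ x∈
... | a+1<x , x≤ = <-trans (n<1+n a) a+1<x , subst (x ≤_) (sym (+-suc a m)) x≤

∈-range⁺ : ∀ {a m x} → a < x → x ≤ a + m → x ∈ range a m
∈-range⁺ {a} {zero}  {x} a<x x≤ = ⊥-elim (<⇒≱ a<x (subst (x ≤_) (+-identityʳ a) x≤))
∈-range⁺ {a} {suc m} {x} a<x x≤ with x ≟ suc a
... | yes refl = here refl
... | no  x≢   = there (∈-range⁺ (≤∧≢⇒< a<x (λ e → x≢ (sym e))) (subst (x ≤_) (+-suc a m) x≤))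

-- the last element of between s b is b - 1
between-last : ∀ {s b} → s < b → suc (s + (b ∸ suc s)) ≡ b
between-last {s} {suc b} (s≤s s≤b) = cong suc (m+[n∸m]≡n s≤b)

∈-between⁻ : ∀ {s b x} → s < b → x ∈ between s b → s < x × x < b
∈-between⁻ s<b x∈ with ∈-range⁻ x∈
... | s<x , x≤ = s<x , subst (_ <_) (between-last s<b) (s≤s x≤)

∈-between⁺ : ∀ {s b x} → s < x → x < b → x ∈ between s b
∈-between⁺ s<x x<b =
  ∈-range⁺ s<x (≤-pred (subst (_ ≤_) (sym (between-last (<-trans s<x x<b))) x<b))

range-++ : ∀ a m j → range a (m + j) ≡ range a m ++ range (a + m) j
range-++ a zero    j rewrite +-identityʳ a = refl
range-++ a (suc m) j rewrite range-++ (suc a) m j | +-suc a m = refl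

range-split : ∀ s m j → range s (m + suc j) ≡ range s m ++ (s + suc m) ∷ range (s + suc m) j
range-split s m j rewrite range-++ s m (suc j) | +-suc s m = refl

block≡range : ∀ a m → block a m ≡ range a m
block≡range a m =
  trans (map-applyUpTo (λ i → i) (λ i → a + suc i) m) (applyUpTo-range (λ i → a + suc i) a m (λ _ → refl))
  where
  applyUpTo-range : ∀ (f : ℕ → ℕ) a m → (∀ i → f i ≡ a + suc i) → applyUpTo f m ≡ range a m
  applyUpTo-range f a zero    _ = refl
  applyUpTo-range f a (suc m) h =
    cong₂ _∷_ (trans (h 0) (trans (+-suc a 0) (cong suc (+-identityʳ a))))
              (applyUpTo-range (λ i → f (suc i)) (suc a) m (λ i → trans (h (suc i)) (+-suc a (suc i))))

count-window : ∀ (p : ℕ → Bool) s N a m → s ≤ a → a + m ≤ s + N →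
  (∀ x → ¬ (a < x × x ≤ a + m) → p x ≡ false) → countᵇ p (range s N) ≡ countᵇ p (range a m)
count-window p s N a m s≤a a+m≤ outside =
  begin
    countᵇ p (range s N)
      ≡⟨ cong (λ n → countᵇ p (range s n)) N≡ ⟩
    countᵇ p (range s (u + (m + d)))
      ≡⟨ cong (countᵇ p) (range-++ s u (m + d)) ⟩
    countᵇ p (range s u ++ range (s + u) (m + d))
      ≡⟨ cong (λ b → countᵇ p (range s u ++ range b (m + d))) s+u≡a ⟩
    countᵇ p (range s u ++ range a (m + d))
      ≡⟨ cong (λ xs → countᵇ p (range s u ++ xs)) (range-++ a m d) ⟩
    countᵇ p (range s u ++ (range a m ++ range (a + m) d))
      ≡⟨ count-++ p (range s u) _ ⟩
    countᵇ p (range s u) + countᵇ p (range a m ++ range (a + m) d)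
      ≡⟨ cong₂ _+_ (count-zero (range s u) before) (count-++ p (range a m) _) ⟩
    countᵇ p (range a m) + countᵇ p (range (a + m) d)
      ≡⟨ cong (countᵇ p (range a m) +_) (count-zero (range (a + m) d) after) ⟩
    countᵇ p (range a m) + 0
      ≡⟨ +-identityʳ _ ⟩
    countᵇ p (range a m) ∎
  where
  open ≡-Reasoning
  u d : ℕ
  u = a ∸ s
  d = (s + N) ∸ (a + m)
  s+u≡a : s + u ≡ a
  s+u≡a = m+[n∸m]≡n s≤a
  before : ∀ x → x ∈ range s u → p x ≡ false
  before x x∈ = outside x (λ (a<x , _) → <⇒≱ a<x (subst (x ≤_) s+u≡a (proj₂ (∈-range⁻ x∈))))
  after : ∀ x → x ∈ range (a + m) d → p x ≡ false
  after x x∈ = outside x (λ (_ , x≤) → <⇒≱ (proj₁ (∈-range⁻ x∈)) x≤)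
  N≡ : N ≡ u + (m + d)
  N≡ = +-cancelˡ-≡ s _ _ (begin
    s + N             ≡⟨ sym (m+[n∸m]≡n a+m≤) ⟩
    a + m + d         ≡⟨ +-assoc a m d ⟩
    a + (m + d)       ≡⟨ cong (_+ (m + d)) (sym (m+[n∸m]≡n s≤a)) ⟩
    s + u + (m + d)   ≡⟨ +-assoc s u (m + d) ⟩
    s + (u + (m + d)) ∎)

-- A tree numbered from s+1 carries the labels (s, s + |t|]; in
-- node l r the root is labelled k = s + suc |l|, the left subtree occupies
-- (s, k) and the right subtree (k, k + |r|], which ends at s + |node l r|.

labels≡range : ∀ s t → labels s t ≡ range s (size t)
labels≡range s leaf       = refl
labels≡range s (node l r)
  rewrite labels≡range s l | labels≡range (s + suc (size l)) r = sym (range-split s (size l) (size r))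

module RootLabel (s L : ℕ) where
  k : ℕ
  k = s + suc L

  s<k : s < k
  s<k = subst (s <_) (sym (+-suc s L)) (s≤s (m≤m+n s L))

  leftEnd<k : s + L < k
  leftEnd<k = subst (s + L <_) (sym (+-suc s L)) ≤-refl

  end≡ : ∀ R → s + (L + suc R) ≡ k + R
  end≡ R = trans (cong (s +_) (+-suc L R)) (sym (+-assoc s (suc L) R))

  leftEnd≤end : ∀ R → s + L ≤ s + (L + suc R)
  leftEnd≤end R = +-monoʳ-≤ s (m≤m+n L (suc R))

labelᵇ : ℕ → Tree → ℕ → Bool
labelᵇ k t c = anyᵇ (λ x → x ≡ᵇ c) (labels k t)

labelᵇ-true : ∀ {k c} t → k < c → c ≤ k + size t → labelᵇ k t c ≡ true
labelᵇ-true {k} {c} t k<c c≤ =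
  any-intro (subst (c ∈_) (sym (labels≡range k t)) (∈-range⁺ k<c c≤)) (≡ᵇ-true {c} refl)

labelᵇ-bounds : ∀ {k c} t → labelᵇ k t c ≡ true → k < c × c ≤ k + size t
labelᵇ-bounds {k} {c} t e with any-elim (labels k t) e
... | x , x∈ , x≡c rewrite ≡ᵇ⇒≡ x c (≡true⇒T x≡c) =
  ∈-range⁻ (subst (c ∈_) (labels≡range k t) x∈)

labelᵇ-false : ∀ {k c} t → ¬ (k < c × c ≤ k + size t) → labelᵇ k t c ≡ false
labelᵇ-false {k} {c} t = false-unless (labelᵇ k t c) (labelᵇ-bounds t)

rightSub-bounds : ∀ s t a b → rightSub s t a b ≡ true → s < a × a < b × b ≤ s + size t
rightSub-bounds s (node l r) a b e =
  byCase (∨-true ((a ≡ᵇ k) ∧ labelᵇ k r b) (rightSub s l a b ∨ rightSub k r a b) e)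
  where
  open RootLabel s (size l)
  fromRoot : a ≡ k → labelᵇ k r b ≡ true → s < a × a < b × b ≤ s + size (node l r)
  fromRoot refl b∈r with labelᵇ-bounds r b∈r
  ... | k<b , b≤ = s<k , k<b , subst (b ≤_) (sym (end≡ (size r))) b≤
  fromLeft : rightSub s l a b ≡ true → s < a × a < b × b ≤ s + size (node l r)
  fromLeft inL with rightSub-bounds s l a b inL
  ... | s<a , a<b , b≤ = s<a , a<b , ≤-trans b≤ (leftEnd≤end (size r))
  fromRight : rightSub k r a b ≡ true → s < a × a < b × b ≤ s + size (node l r)
  fromRight inR with rightSub-bounds k r a b inR
  ... | k<a , a<b , b≤ = <-trans s<k k<a , a<b , subst (b ≤_) (sym (end≡ (size r))) b≤
  byCase : ((a ≡ᵇ k) ∧ labelᵇ k r b) ≡ true ⊎ (rightSub s l a b ∨ rightSub k r a b) ≡ true →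
           s < a × a < b × b ≤ s + size (node l r)
  byCase (inj₁ atRoot) with ∧-true (a ≡ᵇ k) (labelᵇ k r b) atRoot
  ... | a≡k , b∈r = fromRoot (≡ᵇ⇒≡ a k (≡true⇒T a≡k)) b∈r
  byCase (inj₂ inSub) with ∨-true (rightSub s l a b) (rightSub k r a b) inSub
  ... | inj₁ inL = fromLeft inL
  ... | inj₂ inR = fromRight inR

rightSub-false : ∀ s t a b → ¬ (s < a × a < b × b ≤ s + size t) → rightSub s t a b ≡ false
rightSub-false s t a b = false-unless (rightSub s t a b) (rightSub-bounds s t a b)

rightSub-left : ∀ s l r a b → a < s + suc (size l) → rightSub s (node l r) a b ≡ rightSub s l a b
rightSub-left s l r a b a<k
  rewrite ≡ᵇ-false (<⇒≢ a<k)
        | rightSub-false (s + suc (size l)) r a b (λ (k<a , _) → <-asym a<k k<a) = ∨-identityʳ _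

rightSub-right : ∀ s l r a b → s + suc (size l) < a →
                 rightSub s (node l r) a b ≡ rightSub (s + suc (size l)) r a b
rightSub-right s l r a b k<a
  rewrite ≡ᵇ-false (λ a≡k → <⇒≢ k<a (sym a≡k))
        | rightSub-false s l a b
            (λ (_ , a<b , b≤) → <-asym k<a (<-trans a<b (≤-<-trans b≤ (RootLabel.leftEnd<k s (size l))))) =
  refl

rightSub-root : ∀ s l r b → rightSub s (node l r) (s + suc (size l)) b ≡ labelᵇ (s + suc (size l)) r b
rightSub-root s l r b
  rewrite ≡ᵇ-true {s + suc (size l)} refl
        | rightSub-false s l (s + suc (size l)) b
            (λ (_ , k<b , b≤) → <-asym (RootLabel.leftEnd<k s (size l)) (<-≤-trans k<b b≤))
        | rightSub-false (s + suc (size l)) r (s + suc (size l)) b (λ (k<k , _) → <-irrefl refl k<k) =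
  ∨-identityʳ _

-- RightSubtreeAt s t i r: in t numbered from
-- s+1, the node v_i has right subtree r.

data RightSubtreeAt : ℕ → Tree → ℕ → Tree → Set where
  at-root  : ∀ {s l r} → RightSubtreeAt s (node l r) (s + suc (size l)) r
  in-left  : ∀ {s l r i r′} → RightSubtreeAt s l i r′ → RightSubtreeAt s (node l r) i r′
  in-right : ∀ {s l r i r′} → RightSubtreeAt (s + suc (size l)) r i r′ → RightSubtreeAt s (node l r) i r′

locate : ∀ s t i → s < i → i ≤ s + size t → Σ Tree (RightSubtreeAt s t i)
locate s leaf       i s<i i≤ = ⊥-elim (<⇒≱ s<i (subst (i ≤_) (+-identityʳ s) i≤))
locate s (node l r) i s<i i≤ with <-cmp i (s + suc (size l))
... | tri< i<k _ _ with locate s l i s<i (≤-pred (subst (suc i ≤_) (+-suc s (size l)) i<k))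
...   | r′ , at = r′ , in-left at
locate s (node l r) i s<i i≤ | tri≈ _ refl _ = r , at-root
locate s (node l r) i s<i i≤ | tri> _ _ k<i
  with locate (s + suc (size l)) r i k<i (subst (i ≤_) (RootLabel.end≡ s (size l) (size r)) i≤)
...   | r′ , at = r′ , in-right at

subtree-bounds : ∀ {s t i r} → RightSubtreeAt s t i r → s < i × i + size r ≤ s + size t
subtree-bounds {s} (at-root {l = l} {r = r}) = s<k , ≤-reflexive (sym (end≡ (size r)))
  where open RootLabel s (size l)
subtree-bounds {s} (in-left {l = l} {r = r} at) with subtree-bounds at
... | s<i , end≤ = s<i , ≤-trans end≤ (RootLabel.leftEnd≤end s (size l) (size r))
subtree-bounds {s} (in-right {l = l} {r = r} {i = i} {r′ = r′} at) with subtree-bounds at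
... | k<i , end≤ = <-trans (RootLabel.s<k s (size l)) k<i
                 , subst (i + size r′ ≤_) (sym (RootLabel.end≡ s (size l) (size r))) end≤

left-of-root : ∀ {s l i r′ a} → RightSubtreeAt s l i r′ → a ≤ i + size r′ → a < s + suc (size l)
left-of-root {s} {l} at a≤ =
  ≤-<-trans (≤-trans a≤ (proj₂ (subtree-bounds at))) (RootLabel.leftEnd<k s (size l))

rightSub-fromNode : ∀ {s t i r} c → RightSubtreeAt s t i r → rightSub s t i c ≡ labelᵇ i r c
rightSub-fromNode {s} c (at-root {l = l} {r = r}) = rightSub-root s l r c
rightSub-fromNode {s} c (in-left {l = l} {r = r} {i = i} at) =
  trans (rightSub-left s l r i c (left-of-root at (m≤m+n i _))) (rightSub-fromNode c at)
rightSub-fromNode {s} c (in-right {l = l} {r = r} {i = i} at) =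
  trans (rightSub-right s l r i c (proj₁ (subtree-bounds at))) (rightSub-fromNode c at)

rightSub-inSubtree : ∀ {s t i r} a b → RightSubtreeAt s t i r → i < a → a ≤ i + size r →
                     rightSub s t a b ≡ rightSub i r a b
rightSub-inSubtree {s} a b (at-root {l = l} {r = r}) k<a _ = rightSub-right s l r a b k<a
rightSub-inSubtree {s} a b (in-left {l = l} {r = r} at) i<a a≤ =
  trans (rightSub-left s l r a b (left-of-root at a≤)) (rightSub-inSubtree a b at i<a a≤)
rightSub-inSubtree {s} a b (in-right {l = l} {r = r} at) i<a a≤ =
  trans (rightSub-right s l r a b (<-trans (proj₁ (subtree-bounds at)) i<a)) (rightSub-inSubtree a b at i<a a≤)

isRootIn : ℕ → Tree → ℕ → Bool
isRootIn s t b = not (anyᵇ (λ a → rightSub s t a b) (between s b))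

isChildIn : ℕ → Tree → ℕ → ℕ → Bool
isChildIn s t i c =
  (i <ᵇ c) ∧ rightSub s t i c ∧ not (anyᵇ (λ d → rightSub s t d c ∧ rightSub s t i d) (between i c))

spine : Tree → ℕ
spine leaf       = 0
spine (node l r) = suc (spine l)

-- The roots are the nodes of the left branch: the root of node l r is a root,
-- the roots of l remain roots, and every node of r lies right of the root.
roots-count : ∀ s t → countᵇ (isRootIn s t) (range s (size t)) ≡ spine t
roots-count s leaf       = refl
roots-count s (node l r) =
  begin
    countᵇ P (range s (size l + suc (size r)))
      ≡⟨ cong (countᵇ P) (range-split s (size l) (size r)) ⟩
    countᵇ P (range s (size l) ++ k ∷ range k (size r))
      ≡⟨ count-++ P (range s (size l)) _ ⟩
    countᵇ P (range s (size l)) + countᵇ P (k ∷ range k (size r))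
      ≡⟨ cong₂ _+_ (count-cong (range s (size l)) leftRoots)
                   (count-∷-true P {k} (range k (size r)) rootIsRoot) ⟩
    countᵇ (isRootIn s l) (range s (size l)) + suc (countᵇ P (range k (size r)))
      ≡⟨ cong₂ (λ x y → x + suc y) (roots-count s l) (count-zero (range k (size r)) rightNoRoots) ⟩
    spine l + 1
      ≡⟨ +-comm (spine l) 1 ⟩
    suc (spine l) ∎
  where
  open ≡-Reasoning
  open RootLabel s (size l)
  P : ℕ → Bool
  P = isRootIn s (node l r)
  leftRoots : ∀ b → b ∈ range s (size l) → P b ≡ isRootIn s l b
  leftRoots b b∈ with ∈-range⁻ b∈
  ... | s<b , b≤ = cong not (any-cong (between s b) (λ a a∈ →
          rightSub-left s l r a b (<-trans (proj₂ (∈-between⁻ s<b a∈)) (≤-<-trans b≤ leftEnd<k))))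
  rootIsRoot : P k ≡ true
  rootIsRoot = cong not (any-false (between s k) (λ a a∈ →
    trans (rightSub-left s l r a k (proj₂ (∈-between⁻ s<k a∈)))
          (rightSub-false s l a k (λ (_ , _ , k≤) → <⇒≱ leftEnd<k k≤))))
  rightNoRoots : ∀ c → c ∈ range k (size r) → P c ≡ false
  rightNoRoots c c∈ with ∈-range⁻ c∈
  ... | k<c , c≤ =
    cong not (any-intro (∈-between⁺ s<k k<c) (trans (rightSub-root s l r c) (labelᵇ-true r k<c c≤)))

-- The children of v_i are the roots of its right subtree r: only the labels of r
-- are candidates, and for them the covering condition is rootedness in r.
children-count : ∀ {s t i r} → RightSubtreeAt s t i r → countᵇ (isChildIn s t i) (range s (size t)) ≡ spine r
children-count {s} {t} {i} {r} at =
  begin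
    countᵇ (isChildIn s t i) (range s (size t))
      ≡⟨ count-window (isChildIn s t i) s (size t) i (size r) (<⇒≤ (proj₁ (subtree-bounds at)))
                      (proj₂ (subtree-bounds at)) outside ⟩
    countᵇ (isChildIn s t i) (range i (size r))
      ≡⟨ count-cong (range i (size r)) inside ⟩
    countᵇ (isRootIn i r) (range i (size r))
      ≡⟨ roots-count i r ⟩
    spine r ∎
  where
  open ≡-Reasoning
  outside : ∀ c → ¬ (i < c × c ≤ i + size r) → isChildIn s t i c ≡ false
  outside c c∉ rewrite rightSub-fromNode c at | labelᵇ-false r c∉ = ∧-zeroʳ (i <ᵇ c)
  -- an intermediate node d of r is below v_i, so only the relation d ◁ c matters
  throughMiddle : ∀ c d → c ≤ i + size r → i < d → d < c →
                  rightSub s t d c ∧ rightSub s t i d ≡ rightSub i r d c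
  throughMiddle c d c≤ i<d d<c = begin
    rightSub s t d c ∧ rightSub s t i d
      ≡⟨ cong₂ _∧_ (rightSub-inSubtree d c at i<d d≤) (rightSub-fromNode d at) ⟩
    rightSub i r d c ∧ labelᵇ i r d
      ≡⟨ cong (rightSub i r d c ∧_) (labelᵇ-true r i<d d≤) ⟩
    rightSub i r d c ∧ true
      ≡⟨ ∧-identityʳ _ ⟩
    rightSub i r d c ∎
    where
    d≤ : d ≤ i + size r
    d≤ = ≤-trans (<⇒≤ d<c) c≤
  inside : ∀ c → c ∈ range i (size r) → isChildIn s t i c ≡ isRootIn i r c
  inside c c∈ with ∈-range⁻ c∈
  ... | i<c , c≤ rewrite <ᵇ-true i<c | rightSub-fromNode c at | labelᵇ-true r i<c c≤ =
    cong not (any-cong (between i c) (λ d d∈ →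
      let (i<d , d<c) = ∈-between⁻ i<c d∈ in throughMiddle c d c≤ i<d d<c))

-- The interval-poset: its decreasing relations are those of t1, so its
-- decreasing roots and children are those of t1 numbered from 1.

ipRel-decreasing : ∀ t1 t2 {a b} → a < b → ipRel t1 t2 b a ≡ rightSub 0 t1 a b
ipRel-decreasing t1 t2 {a} {b} a<b
  rewrite ≡ᵇ-false (λ b≡a → <⇒≢ a<b (sym b≡a)) | <ᵇ-true a<b | <ᵇ-false (<-asym a<b) =
  ∨-identityʳ _

isDecRoot≡isRootIn : ∀ t1 t2 {b} → 0 < b → isDecRoot t1 t2 b ≡ isRootIn 0 t1 b
isDecRoot≡isRootIn t1 t2 {b} 0<b = cong not (begin
  anyᵇ (λ a → ipRel t1 t2 b a) (block 0 (b ∸ 1))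
    ≡⟨ cong (anyᵇ _) (block≡range 0 (b ∸ 1)) ⟩
  anyᵇ (λ a → ipRel t1 t2 b a) (between 0 b)
    ≡⟨ any-cong (between 0 b) (λ a a∈ → ipRel-decreasing t1 t2 (proj₂ (∈-between⁻ 0<b a∈))) ⟩
  anyᵇ (λ a → rightSub 0 t1 a b) (between 0 b) ∎)
  where open ≡-Reasoning

isDecChild≡isChildIn : ∀ t1 t2 i c → isDecChild t1 t2 i c ≡ isChildIn 0 t1 i c
isDecChild≡isChildIn t1 t2 i c = ∧-congʳ (i <ᵇ c) λ i<ᵇc →
  let i<c = <ᵇ⇒< i c (≡true⇒T i<ᵇc) in
  cong₂ _∧_ (ipRel-decreasing t1 t2 i<c) (cong not (begin
    anyᵇ (λ d → ipRel t1 t2 c d ∧ ipRel t1 t2 d i) (block i (c ∸ suc i))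
      ≡⟨ cong (anyᵇ _) (block≡range i (c ∸ suc i)) ⟩
    anyᵇ (λ d → ipRel t1 t2 c d ∧ ipRel t1 t2 d i) (between i c)
      ≡⟨ any-cong (between i c) (λ d d∈ → let (i<d , d<c) = ∈-between⁻ i<c d∈ in
           cong₂ _∧_ (ipRel-decreasing t1 t2 d<c) (ipRel-decreasing t1 t2 i<d)) ⟩
    anyᵇ (λ d → rightSub 0 t1 d c ∧ rightSub 0 t1 i d) (between i c) ∎))
  where open ≡-Reasoning

decRoots-count : ∀ t1 t2 → dc₀ (size t1) t1 t2 ≡ spine t1
decRoots-count t1 t2 = begin
  countᵇ (isDecRoot t1 t2) (block 0 (size t1))
    ≡⟨ cong (countᵇ _) (block≡range 0 (size t1)) ⟩
  countᵇ (isDecRoot t1 t2) (range 0 (size t1))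
    ≡⟨ count-cong (range 0 (size t1)) (λ b b∈ → isDecRoot≡isRootIn t1 t2 (proj₁ (∈-range⁻ b∈))) ⟩
  countᵇ (isRootIn 0 t1) (range 0 (size t1))
    ≡⟨ roots-count 0 t1 ⟩
  spine t1 ∎
  where open ≡-Reasoning

decChildren-count : ∀ t1 t2 {i r} → RightSubtreeAt 0 t1 i r → dc (size t1) t1 t2 i ≡ spine r
decChildren-count t1 t2 {i} {r} at = begin
  countᵇ (isDecChild t1 t2 i) (block 0 (size t1))
    ≡⟨ cong (countᵇ _) (block≡range 0 (size t1)) ⟩
  countᵇ (isDecChild t1 t2 i) (range 0 (size t1))
    ≡⟨ count-cong (range 0 (size t1)) (λ c _ → isDecChild≡isChildIn t1 t2 i c) ⟩
  countᵇ (isChildIn 0 t1 i) (range 0 (size t1))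
    ≡⟨ children-count at ⟩
  spine r ∎
  where open ≡-Reasoning

toDyck-node : ∀ l r ys → toDyck (node l r) ++ ys ≡ toDyck l ++ true ∷ (toDyck r ++ false ∷ ys)
toDyck-node l r ys =
  trans (++-assoc (toDyck l) _ ys) (cong (λ p → toDyck l ++ true ∷ p) (++-assoc (toDyck r) _ ys))

zeros : ℕ → Dyck → ℕ
zeros h d = countᵇ (λ x → x ≡ᵇ 0) (heightsBut-last h d)

zeros-above : ∀ h t ys → zeros (suc h) (toDyck t ++ ys) ≡ zeros (suc h) ys
zeros-above h leaf       ys = refl
zeros-above h (node l r) ys = begin
  zeros (suc h) (toDyck (node l r) ++ ys)                     ≡⟨ cong (zeros (suc h)) (toDyck-node l r ys) ⟩
  zeros (suc h) (toDyck l ++ true ∷ (toDyck r ++ false ∷ ys)) ≡⟨ zeros-above h l _ ⟩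
  zeros (suc (suc h)) (toDyck r ++ false ∷ ys)                ≡⟨ zeros-above (suc h) r _ ⟩
  zeros (suc h) ys                                            ∎
  where open ≡-Reasoning

zeros-ground : ∀ t ys → zeros 0 (toDyck t ++ ys) ≡ spine t + zeros 0 ys
zeros-ground leaf       ys = refl
zeros-ground (node l r) ys = begin
  zeros 0 (toDyck (node l r) ++ ys)                     ≡⟨ cong (zeros 0) (toDyck-node l r ys) ⟩
  zeros 0 (toDyck l ++ true ∷ (toDyck r ++ false ∷ ys)) ≡⟨ zeros-ground l _ ⟩
  spine l + suc (zeros 1 (toDyck r ++ false ∷ ys))      ≡⟨ cong (λ z → spine l + suc z) (zeros-above 0 r _) ⟩
  spine l + suc (zeros 0 ys)                            ≡⟨ +-suc (spine l) _ ⟩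
  spine (node l r) + zeros 0 ys                         ∎
  where open ≡-Reasoning

contacts-spine : ∀ t → contacts (toDyck t) ≡ spine t
contacts-spine t = begin
  zeros 0 (toDyck t)       ≡⟨ cong (zeros 0) (sym (++-identityʳ (toDyck t))) ⟩
  zeros 0 (toDyck t ++ []) ≡⟨ zeros-ground t [] ⟩
  spine t + 0              ≡⟨ +-identityʳ (spine t) ⟩
  spine t                  ∎
  where open ≡-Reasoning

-- The i-th up-step of path(t) is that of v_i (in-order), and it is matched by
-- the down-step closing path(r) for the right subtree r of v_i.

afterUp-skip : ∀ t j ys → afterUp (size t + j) (toDyck t ++ ys) ≡ afterUp j ys
afterUp-skip leaf       j ys = refl
afterUp-skip (node l r) j ys = begin
  afterUp (size l + suc (size r) + j) (toDyck (node l r) ++ ys)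
    ≡⟨ cong₂ afterUp (+-assoc (size l) (suc (size r)) j) (toDyck-node l r ys) ⟩
  afterUp (size l + suc (size r + j)) (toDyck l ++ true ∷ (toDyck r ++ false ∷ ys))
    ≡⟨ afterUp-skip l (suc (size r + j)) _ ⟩
  afterUp (size r + j) (toDyck r ++ false ∷ ys)
    ≡⟨ afterUp-skip r j (false ∷ ys) ⟩
  afterUp j ys ∎
  where open ≡-Reasoning

-- the number of up-steps before that of v_i, when v_i is the root or in the right subtree
index-root : ∀ s L → s + suc L ∸ suc s ≡ L
index-root s L = trans (cong (_∸ suc s) (+-suc s L)) (m+n∸m≡n s L)

index-right : ∀ s L i → s + suc L < i → i ∸ suc s ≡ L + suc (i ∸ suc (s + suc L))
index-right s L i k<i = begin
  i ∸ suc s                           ≡⟨ cong (_∸ suc s) (sym (m+[n∸m]≡n k<i)) ⟩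
  suc (s + suc L) + j ∸ suc s         ≡⟨ cong (λ x → suc x ∸ suc s) (+-assoc s (suc L) j) ⟩
  suc s + (suc L + j) ∸ suc s         ≡⟨ m+n∸m≡n (suc s) (suc L + j) ⟩
  suc L + j                           ≡⟨ sym (+-suc L j) ⟩
  L + suc j                           ∎
  where
  open ≡-Reasoning
  j : ℕ
  j = i ∸ suc (s + suc L)

afterUp-subtree : ∀ {s t i r} ys → RightSubtreeAt s t i r →
                  ∃[ zs ] afterUp (i ∸ suc s) (toDyck t ++ ys) ≡ toDyck r ++ false ∷ zs
afterUp-subtree {s} ys (at-root {l = l} {r = r}) = ys , (begin
  afterUp (s + suc (size l) ∸ suc s) (toDyck (node l r) ++ ys)
    ≡⟨ cong₂ afterUp (trans (index-root s (size l)) (sym (+-identityʳ (size l)))) (toDyck-node l r ys) ⟩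
  afterUp (size l + 0) (toDyck l ++ true ∷ (toDyck r ++ false ∷ ys))
    ≡⟨ afterUp-skip l 0 _ ⟩
  toDyck r ++ false ∷ ys ∎)
  where open ≡-Reasoning
afterUp-subtree {s} {i = i} ys (in-left {l = l} {r = r} at)
  with afterUp-subtree (true ∷ (toDyck r ++ false ∷ ys)) at
... | zs , eq = zs , trans (cong (afterUp (i ∸ suc s)) (toDyck-node l r ys)) eq
afterUp-subtree {s} {i = i} {r = r′} ys (in-right {l = l} {r = r} at) with afterUp-subtree (false ∷ ys) at
... | zs , eq = zs , (begin
  afterUp (i ∸ suc s) (toDyck (node l r) ++ ys)
    ≡⟨ cong₂ afterUp (index-right s (size l) i (proj₁ (subtree-bounds at))) (toDyck-node l r ys) ⟩
  afterUp (size l + suc (i ∸ suc k)) (toDyck l ++ true ∷ (toDyck r ++ false ∷ ys))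
    ≡⟨ afterUp-skip l (suc (i ∸ suc k)) _ ⟩
  afterUp (i ∸ suc k) (toDyck r ++ false ∷ ys)
    ≡⟨ eq ⟩
  toDyck r′ ++ false ∷ zs ∎)
  where
  open ≡-Reasoning
  k : ℕ
  k = s + suc (size l)

-- a tree's path never goes below its starting height
untilMatch-toDyck : ∀ h t ys → untilMatch h (toDyck t ++ ys) ≡ toDyck t ++ untilMatch h ys
untilMatch-toDyck h leaf       ys = refl
untilMatch-toDyck h (node l r) ys = begin
  untilMatch h (toDyck (node l r) ++ ys)                     ≡⟨ cong (untilMatch h) (toDyck-node l r ys) ⟩
  untilMatch h (toDyck l ++ true ∷ (toDyck r ++ false ∷ ys)) ≡⟨ untilMatch-toDyck h l _ ⟩
  toDyck l ++ true ∷ untilMatch (suc h) (toDyck r ++ false ∷ ys)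
    ≡⟨ cong (λ p → toDyck l ++ true ∷ p) (untilMatch-toDyck (suc h) r (false ∷ ys)) ⟩
  toDyck l ++ true ∷ (toDyck r ++ false ∷ untilMatch h ys)   ≡⟨ sym (toDyck-node l r _) ⟩
  toDyck (node l r) ++ untilMatch h ys                       ∎
  where open ≡-Reasoning

contactsAt-spine : ∀ {t i r} → RightSubtreeAt 0 t i r → contactsAt i (toDyck t) ≡ spine r
contactsAt-spine {t} {i} {r} at with afterUp-subtree [] at
... | zs , eq = begin
  contacts (untilMatch 0 (afterUp (i ∸ 1) (toDyck t)))
    ≡⟨ cong (λ p → contacts (untilMatch 0 (afterUp (i ∸ 1) p))) (sym (++-identityʳ (toDyck t))) ⟩
  contacts (untilMatch 0 (afterUp (i ∸ 1) (toDyck t ++ [])))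
    ≡⟨ cong (λ p → contacts (untilMatch 0 p)) eq ⟩
  contacts (untilMatch 0 (toDyck r ++ false ∷ zs))
    ≡⟨ cong contacts (untilMatch-toDyck 0 r (false ∷ zs)) ⟩
  contacts (toDyck r ++ [])
    ≡⟨ cong contacts (++-identityʳ (toDyck r)) ⟩
  contacts (toDyck r)
    ≡⟨ contacts-spine r ⟩
  spine r ∎
  where open ≡-Reasoning

-- Both sides count left branches in t1: of t1 itself for the roots, and of the
-- right subtree of v_i for the children of i.
proposition3p6 : (n : ℕ) (t1 t2 : Tree) → size t1 ≡ n → size t2 ≡ n → t1 ≤T t2 →
                   (dc₀ n t1 t2 ≡ contacts (toDyck t1))
                   × ((i : ℕ) → 1 ≤ i → i < n → dc n t1 t2 i ≡ contactsAt i (toDyck t1))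
proposition3p6 .(size t1) t1 t2 refl _ _ = roots , children
  where
  roots : dc₀ (size t1) t1 t2 ≡ contacts (toDyck t1)
  roots = trans (decRoots-count t1 t2) (sym (contacts-spine t1))
  children : (i : ℕ) → 1 ≤ i → i < size t1 → dc (size t1) t1 t2 i ≡ contactsAt i (toDyck t1)
  children i 1≤i i<n with locate 0 t1 i 1≤i (<⇒≤ i<n)
  ... | r , at = trans (decChildren-count t1 t2 at) (sym (contactsAt-spine at))
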